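{- For every positive integer $q$, $2q+3\le\operatorname{achr}(K_6\square K_q)\le 2q+6$.
   Context: For a finite simple graph $G$, $\operatorname{achr}(G)$ (the achromatic number) is the maximum number of colours in a proper vertex colouring of $G$ that is complete, i.e. every pair of distinct colours appears on the two ends of some edge. $K_6\square K_q$ is the Cartesian product of the complete graphs $K_6$ and $K_q$ (vertex set $[1,6]\times[1,q]$, two vertices adjacent iff they agree in exactly one coordinate). -}

module Defs where

open import Data.Nat using (ℕ; _≤_)
open import Data.Fin using (Fin)
open import Data.Product using (_×_; _,_; ∃-syntax)
open import Data.Sum using (_⊎_; inj₁; inj₂)
open import Relation.Binary.PropositionalEquality using (_≡_; _≢_; sym)
open import Relation.Nullary using (¬_)

-- A simple graph on a vertex type V: symmetric irreflexive adjacency.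
-- (Finiteness: the only graph used below has vertex type Fin 6 × Fin q.)
record Graph (V : Set) : Set₁ where
  field
    Adj       : V → V → Set
    Adj-sym   : ∀ {u v} → Adj u v → Adj v u
    Adj-irr   : ∀ {u} → ¬ Adj u u
open Graph public

record CompleteColouring {V : Set} (G : Graph V) (k : ℕ) : Set where
  field
    colour   : V → Fin k
    proper   : ∀ u v → Adj G u v → colour u ≢ colour v
    surj     : ∀ (i : Fin k) → ∃[ u ] colour u ≡ i
    complete : ∀ (i j : Fin k) → i ≢ j →
               ∃[ u ] ∃[ v ] (Adj G u v × colour u ≡ i × colour v ≡ j)

-- achr(G) is the maximum k admitting a complete colouring.
-- m ≤ achr(G) : some complete colouring has at least m colours.
AchrGE : {V : Set} → Graph V → ℕ → Set
AchrGE G m = ∃[ k ] (m ≤ k × CompleteColouring G k)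

-- achr(G) ≤ m : every complete colouring has at most m colours.
AchrLE : {V : Set} → Graph V → ℕ → Set
AchrLE G m = ∀ k → CompleteColouring G k → k ≤ m

-- K_p □ K_q : vertices (a , b), adjacent iff they agree in exactly one coordinate.
KAdj : (p q : ℕ) → (Fin p × Fin q) → (Fin p × Fin q) → Set
KAdj p q (a , b) (a' , b') = (a ≡ a' × b ≢ b') ⊎ (a ≢ a' × b ≡ b')

KAdj-sym : ∀ {p q} {u v} → KAdj p q u v → KAdj p q v u
KAdj-sym (inj₁ (e , d)) = inj₁ (sym e , λ x → d (sym x))
KAdj-sym (inj₂ (d , e)) = inj₂ ((λ x → d (sym x)) , sym e)

KAdj-irr : ∀ {p q} {u} → ¬ KAdj p q u u
KAdj-irr (inj₁ (_ , d)) = d _≡_.refl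
KAdj-irr (inj₂ (d , _)) = d _≡_.refl

KK : (p q : ℕ) → Graph (Fin p × Fin q)
KK p q = record { Adj = KAdj p q ; Adj-sym = KAdj-sym ; Adj-irr = KAdj-irr }

-- Suppose a complete colouring of K₆ □ K_q uses k ≥ 2q + 7 colours.  A colour class
-- meets every other colour inside the rows and columns of its vertices.  Hence no class is a
-- singleton (its row and column hold only q + 5 vertices), and no two classes of exactly two
-- vertices occupy the same pair of rows (the two rows and two columns of one of them hold only
-- 2q + 8 vertices, yet contain a representative of every colour and the second vertices of both
-- classes).  So every class has three distinct tokens, namely three of its vertices, or its two
-- vertices and the code of its pair of rows, and tokens of different classes differ: 3k ≤ 6q + 15.
--
-- Identify the six rows with the edges of K₄; the star of a vertex of K₄ is the set
-- of its three edges, and any two stars share an edge.  If every colour occurs in a row of every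
-- star, we may add four (resp. six) new columns carrying eight (resp. twelve) new colours, each
-- occupying the three rows of one star: a new colour then shares a row with every other colour,
-- and the invariant is preserved.  Explicit colourings for q = 3, 4 start this induction; the
-- cases q = 1, 2, 5, 6 are covered by further explicit colourings.
module Submission where

open import Defs
open import Data.Empty using (⊥; ⊥-elim)
open import Data.Fin using (Fin; zero; suc; punchIn; punchOut; splitAt; _↑ˡ_; _↑ʳ_; #_)
import Data.Fin as Fin
open import Data.Fin.Properties
  using ( _≟_; _<?_; any?; all?; <-cmp; <⇒≢; injective⇒≤; +↔⊎; *↔×
        ; punchOut-injective; punchIn-punchOut
        ; ↑ˡ-injective; ↑ʳ-injective; splitAt-↑ˡ; splitAt-↑ʳ; splitAt⁻¹-↑ˡ; splitAt⁻¹-↑ʳ)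
open import Data.Nat using (ℕ; _+_; _*_; _≤_; _<_; z≤n; s≤s)
import Data.Nat as ℕ
open import Data.Nat.Properties
  using ( ≤-refl; ≤-trans; ≤-<-trans; ≰⇒>; <⇒≱; n≤1+n; m≤n*m; m<m+n
        ; +-mono-≤; +-monoʳ-≤; +-monoˡ-<; *-monoˡ-≤)
open import Data.Nat.Tactic.RingSolver using (solve-∀)
open import Data.Product using (_×_; _,_; proj₁; proj₂; ∃; ∃-syntax; Σ-syntax)
open import Data.Product.Properties using (≡-dec)
open import Data.Sum using (_⊎_; inj₁; inj₂; swap; [_,_]′)
open import Data.Sum.Function.Propositional using (_⊎-↔_)
open import Data.Sum.Properties using (inj₁-injective)
open import Data.Unit using (tt)
open import Data.Vec using (Vec; _∷_; []; lookup)
open import Function using (_∘_)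
open import Function.Bundles using (_↔_; _↣_; mk↣; Injection)
open import Function.Construct.Composition using (_↣-∘_; _↔-∘_)
open import Function.Definitions using (Injective)
open import Function.Properties.Inverse using (↔⇒↣; ↔-sym; ↔-refl)
open import Relation.Binary using (tri<; tri≈; tri>)
open import Relation.Binary.Definitions using (DecidableEquality)
open import Relation.Binary.PropositionalEquality
open import Relation.Nullary using (¬_; Dec; yes; no)
open import Relation.Nullary.Decidable
  using (map′; _×-dec_; _⊎-dec_; _→-dec_; ¬?; decidable-stable; toWitness; True)
open import Relation.Unary using (Decidable)

private
  variable
    A B C : Set
    m n : ℕ

injection⇒≤ : Fin m ↔ A → Fin n ↔ B → A ↣ B → m ≤ n
injection⇒≤ finA finB f =
  injective⇒≤ (Injection.injective (↔⇒↣ (↔-sym finB) ↣-∘ (f ↣-∘ ↔⇒↣ finA)))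

retraction-injective : {P : B → Set} {f : A → B} (enc : B → C) (dec : C → B) →
                       (∀ {x} → P x → dec (enc x) ≡ x) → (∀ a → P (f a)) →
                       Injective _≡_ _≡_ f → Injective _≡_ _≡_ (enc ∘ f)
retraction-injective enc dec retract inP f-inj {a} {a'} e =
  f-inj (trans (sym (retract (inP a))) (trans (cong dec e) (retract (inP a'))))

punchOut₂ : {a a' r : Fin (2 + n)} → a ≢ a' → a ≢ r → a' ≢ r → Fin n
punchOut₂ a≢a' a≢r a'≢r = punchOut (a'≢r ∘ punchOut-injective a≢a' a≢r)

punchIn₂ : {a a' : Fin (2 + n)} → a ≢ a' → Fin n → Fin (2 + n)
punchIn₂ {a = a} a≢a' p = punchIn a (punchIn (punchOut a≢a') p)

punchIn₂-punchOut₂ : {a a' r : Fin (2 + n)} (a≢a' : a ≢ a') (a≢r : a ≢ r) (a'≢r : a' ≢ r) →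
                     punchIn₂ a≢a' (punchOut₂ a≢a' a≢r a'≢r) ≡ r
punchIn₂-punchOut₂ {a = a} a≢a' a≢r a'≢r =
  trans (cong (punchIn a) (punchIn-punchOut _)) (punchIn-punchOut a≢r)

three : A → A → A → Fin 3 → A
three x y z zero = x
three x y z (suc zero) = y
three x y z (suc (suc zero)) = z

three-all : {P : A → Set} {x y z : A} → P x → P y → P z → ∀ s → P (three x y z s)
three-all px py pz zero = px
three-all px py pz (suc zero) = py
three-all px py pz (suc (suc zero)) = pz

three-injective : {x y z : A} → x ≢ y → x ≢ z → y ≢ z → Injective _≡_ _≡_ (three x y z)
three-injective x≢y x≢z y≢z {zero} {zero} _ = refl
three-injective x≢y x≢z y≢z {zero} {suc zero} e = ⊥-elim (x≢y e)
three-injective x≢y x≢z y≢z {zero} {suc (suc zero)} e = ⊥-elim (x≢z e)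
three-injective x≢y x≢z y≢z {suc zero} {zero} e = ⊥-elim (x≢y (sym e))
three-injective x≢y x≢z y≢z {suc zero} {suc zero} _ = refl
three-injective x≢y x≢z y≢z {suc zero} {suc (suc zero)} e = ⊥-elim (y≢z e)
three-injective x≢y x≢z y≢z {suc (suc zero)} {zero} e = ⊥-elim (x≢z (sym e))
three-injective x≢y x≢z y≢z {suc (suc zero)} {suc zero} e = ⊥-elim (y≢z (sym e))
three-injective x≢y x≢z y≢z {suc (suc zero)} {suc (suc zero)} _ = refl

[,]-injective : {f : A → C} {g : B → C} → Injective _≡_ _≡_ f → Injective _≡_ _≡_ g →
                (∀ a b → f a ≢ g b) → Injective _≡_ _≡_ [ f , g ]′
[,]-injective f-inj g-inj f≢g {inj₁ a} {inj₁ a'} e = cong inj₁ (f-inj e)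
[,]-injective f-inj g-inj f≢g {inj₁ a} {inj₂ b'} e = ⊥-elim (f≢g a b' e)
[,]-injective f-inj g-inj f≢g {inj₂ b} {inj₁ a'} e = ⊥-elim (f≢g a' b (sym e))
[,]-injective f-inj g-inj f≢g {inj₂ b} {inj₂ b'} e = cong inj₂ (g-inj e)

data Split (m n : ℕ) : Fin (m + n) → Set where
  left  : (x : Fin m) → Split m n (x ↑ˡ n)
  right : (y : Fin n) → Split m n (m ↑ʳ y)

split : ∀ m n (z : Fin (m + n)) → Split m n z
split m n z with splitAt m z in eq
... | inj₁ x = subst (Split m n) (splitAt⁻¹-↑ˡ eq) (left x)
... | inj₂ y = subst (Split m n) (splitAt⁻¹-↑ʳ eq) (right y)

↑ˡ≢↑ʳ : ∀ {m n} (x : Fin m) (y : Fin n) → x ↑ˡ n ≢ m ↑ʳ y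
↑ˡ≢↑ʳ {m} {n} x y e with trans (sym (splitAt-↑ˡ m x n)) (trans (cong (splitAt m) e) (splitAt-↑ʳ m n y))
... | ()

module UpperBound {n q k : ℕ} (C : CompleteColouring (KK (2 + n) q) k) where
  open CompleteColouring C

  Vertex : Set
  Vertex = Fin (2 + n) × Fin q

  row : Vertex → Fin (2 + n)
  row = proj₁

  column : Vertex → Fin q
  column = proj₂

  _≟ᵥ_ : DecidableEquality Vertex
  _≟ᵥ_ = ≡-dec _≟_ _≟_

  anyVertex? : {P : Vertex → Set} → Decidable P → Dec (∃ P)
  anyVertex? P? = map′ (λ (a , b , p) → (a , b) , p) (λ ((a , b) , p) → a , b , p)
                       (any? λ a → any? λ b → P? (a , b))

  same-colour⇒rows-differ : ∀ {u v} → u ≢ v → colour u ≡ colour v → row u ≢ row v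
  same-colour⇒rows-differ {a , b} {a' , b'} u≢v e refl = proper _ _ (inj₁ (refl , λ { refl → u≢v refl })) e

  InCross : Vertex → Vertex → Set
  InCross u w = row w ≡ row u ⊎ column w ≡ column u

  adjacent⇒InCross : ∀ {u w} → KAdj (2 + n) q u w → InCross u w
  adjacent⇒InCross (inj₁ (e , _)) = inj₁ (sym e)
  adjacent⇒InCross (inj₂ (_ , e)) = inj₂ (sym e)

  Representatives : (Vertex → Set) → Set
  Representatives P = ∀ j → Σ[ w ∈ Vertex ] colour w ≡ j × P w

  representative-injective : ∀ {P} (rep : Representatives P) → Injective _≡_ _≡_ (proj₁ ∘ rep)
  representative-injective rep {j} {j'} e =
    trans (sym (proj₁ (proj₂ (rep j)))) (trans (cong colour e) (proj₁ (proj₂ (rep j'))))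

  touching : ∀ {i j} → i ≢ j → ∃[ p ] ∃[ w ] colour p ≡ i × colour w ≡ j × InCross p w
  touching i≢j with complete _ _ i≢j
  ... | p , w , adj , cp , cw = p , w , cp , cw , adjacent⇒InCross adj

  differently-coloured : ∀ {w w' j j'} → colour w ≡ j → colour w' ≡ j' → j ≢ j' → w ≢ w'
  differently-coloured refl refl j≢j' e = j≢j' (cong colour e)

  module Cross (u : Vertex) where
    encode : Vertex → Fin q ⊎ Fin (1 + n)
    encode (r , c) with row u ≟ r
    ... | yes _ = inj₁ c
    ... | no a≢r = inj₂ (punchOut a≢r)

    decode : Fin q ⊎ Fin (1 + n) → Vertex
    decode (inj₁ c) = row u , c
    decode (inj₂ p) = punchIn (row u) p , column u

    decode-encode : ∀ {w} → InCross u w → decode (encode w) ≡ w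
    decode-encode {r , c} w∈ with row u ≟ r
    ... | yes refl = refl
    ... | no a≢r with w∈
    ...   | inj₁ r≡a = ⊥-elim (a≢r (sym r≡a))
    ...   | inj₂ refl = cong (_, c) (punchIn-punchOut a≢r)

  singleton-class-bound : ∀ {i} u → colour u ≡ i → (∀ w → colour w ≡ i → w ≡ u) → k ≤ q + (1 + n)
  singleton-class-bound u refl only-u =
    injection⇒≤ ↔-refl +↔⊎ (mk↣ (retraction-injective encode decode decode-encode
                                    (proj₂ ∘ proj₂ ∘ rep) (representative-injective rep)))
    where
    open Cross u
    rep : Representatives (InCross u)
    rep j with colour u ≟ j
    ... | yes refl = u , refl , inj₁ refl
    ... | no i≢j with touching i≢j
    ...   | p , w , cp , cw , p∼w = w , cw , subst (λ p → InCross p w) (only-u p cp) p∼w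

  record Pair (i : Fin k) : Set where
    field
      lower upper : Vertex
      lower-colour : colour lower ≡ i
      upper-colour : colour upper ≡ i
      rows-ordered : row lower Fin.< row upper

    lower≢upper : lower ≢ upper
    lower≢upper e = <⇒≢ rows-ordered (cong row e)

  record ExactPair (i : Fin k) : Set where
    field
      pair : Pair i
    open Pair pair public
    field
      exhaustive : ∀ w → colour w ≡ i → w ≡ lower ⊎ w ≡ upper

  module Cross₂ (u v : Vertex) (rows-differ : row u ≢ row v) where
    Code : Set
    Code = (Fin q ⊎ Fin q) ⊎ (Fin n ⊎ Fin n)

    encode : Vertex → Code
    encode (r , c) with row u ≟ r | row v ≟ r
    ... | yes _ | _ = inj₁ (inj₁ c)
    ... | no _ | yes _ = inj₁ (inj₂ c)
    ... | no a≢r | no a'≢r with column u ≟ c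
    ...   | yes _ = inj₂ (inj₁ (punchOut₂ rows-differ a≢r a'≢r))
    ...   | no _ = inj₂ (inj₂ (punchOut₂ rows-differ a≢r a'≢r))

    decode : Code → Vertex
    decode (inj₁ (inj₁ c)) = row u , c
    decode (inj₁ (inj₂ c)) = row v , c
    decode (inj₂ (inj₁ p)) = punchIn₂ rows-differ p , column u
    decode (inj₂ (inj₂ p)) = punchIn₂ rows-differ p , column v

    decode-encode : ∀ {w} → InCross u w ⊎ InCross v w → decode (encode w) ≡ w
    decode-encode {r , c} w∈ with row u ≟ r | row v ≟ r
    ... | yes refl | _ = refl
    ... | no _ | yes refl = refl
    ... | no a≢r | no a'≢r with column u ≟ c
    ...   | yes refl = cong (_, c) (punchIn₂-punchOut₂ rows-differ a≢r a'≢r)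
    ...   | no b≢c with w∈
    ...     | inj₁ (inj₁ r≡a) = ⊥-elim (a≢r (sym r≡a))
    ...     | inj₁ (inj₂ c≡b) = ⊥-elim (b≢c (sym c≡b))
    ...     | inj₂ (inj₁ r≡a') = ⊥-elim (a'≢r (sym r≡a'))
    ...     | inj₂ (inj₂ refl) = cong (_, c) (punchIn₂-punchOut₂ rows-differ a≢r a'≢r)

  twin-pairs-bound : ∀ {i i'} → i ≢ i' → (P : ExactPair i) (P' : Pair i') →
                     row (Pair.lower P') ≡ row (ExactPair.lower P) →
                     row (Pair.upper P') ≡ row (ExactPair.upper P) →
                     k + 2 ≤ (q + q) + (n + n)
  twin-pairs-bound {i} {i'} i≢i' P P' rows-lower rows-upper =
    injection⇒≤ +↔⊎ ((+↔⊎ ⊎-↔ +↔⊎) ↔-∘ +↔⊎)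
      (mk↣ (retraction-injective encode decode decode-encode in-crosses
             ([,]-injective (representative-injective rep) second-injective fresh)))
    where
    open ExactPair P
    open Pair P' using ()
      renaming (lower to x; upper to y; lower-colour to x-colour; upper-colour to y-colour; lower≢upper to x≢y)
    open Cross₂ lower upper (<⇒≢ rows-ordered)

    InCross₂ : Vertex → Set
    InCross₂ w = InCross lower w ⊎ InCross upper w

    record Fresh (w : Vertex) : Set where
      field
        in-cross : InCross₂ w
        ≢upper : w ≢ upper
        ≢y : w ≢ y

    rep : Representatives Fresh
    rep j with i ≟ j | i' ≟ j
    ... | yes refl | _ =
      lower , lower-colour , record { in-cross = inj₁ (inj₁ refl) ; ≢upper = lower≢upper
                                    ; ≢y = differently-coloured lower-colour y-colour i≢i' }
    ... | no _ | yes refl =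
      x , x-colour , record { in-cross = inj₁ (inj₁ rows-lower)
                            ; ≢upper = differently-coloured x-colour upper-colour (i≢i' ∘ sym) ; ≢y = x≢y }
    ... | no i≢j | no i'≢j with touching i≢j
    ...   | p , w , cp , cw , p∼w =
      w , cw , record { in-cross = near (exhaustive p cp)
                      ; ≢upper = differently-coloured cw upper-colour (i≢j ∘ sym)
                      ; ≢y = differently-coloured cw y-colour (i'≢j ∘ sym) }
      where
      near : p ≡ lower ⊎ p ≡ upper → InCross₂ w
      near (inj₁ refl) = inj₁ p∼w
      near (inj₂ refl) = inj₂ p∼w

    second : Fin 2 → Vertex
    second zero = upper
    second (suc zero) = y

    second-injective : Injective _≡_ _≡_ second
    second-injective {zero} {zero} _ = refl
    second-injective {zero} {suc zero} e = ⊥-elim (differently-coloured upper-colour y-colour i≢i' e)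
    second-injective {suc zero} {zero} e = ⊥-elim (differently-coloured upper-colour y-colour i≢i' (sym e))
    second-injective {suc zero} {suc zero} _ = refl

    fresh : ∀ j t → proj₁ (rep j) ≢ second t
    fresh j zero = Fresh.≢upper (proj₂ (proj₂ (rep j)))
    fresh j (suc zero) = Fresh.≢y (proj₂ (proj₂ (rep j)))

    in-crosses : ∀ z → InCross₂ ([ proj₁ ∘ rep , second ]′ z)
    in-crosses (inj₁ j) = Fresh.in-cross (proj₂ (proj₂ (rep j)))
    in-crosses (inj₂ zero) = inj₂ (inj₁ refl)
    in-crosses (inj₂ (suc zero)) = inj₂ (inj₁ rows-upper)

  ordered-pair : ∀ {i u v} → u ≢ v → colour u ≡ i → colour v ≡ i →
                 (∀ w → colour w ≡ i → w ≡ u ⊎ w ≡ v) → ExactPair i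
  ordered-pair {u = u} {v} u≢v cu cv exhaustive
    with <-cmp (row u) (row v)
  ... | tri< u<v _ _ = record { pair = record { lower-colour = cu ; upper-colour = cv ; rows-ordered = u<v }
                              ; exhaustive = exhaustive }
  ... | tri≈ _ u≈v _ = ⊥-elim (same-colour⇒rows-differ u≢v (trans cu (sym cv)) u≈v)
  ... | tri> _ _ v<u = record { pair = record { lower-colour = cv ; upper-colour = cu ; rows-ordered = v<u }
                              ; exhaustive = λ w cw → swap (exhaustive w cw) }

  data Shape (i : Fin k) : Set where
    exact-pair : ExactPair i → Shape i
    triple : ∀ u v w → colour u ≡ i → colour v ≡ i → colour w ≡ i →
             u ≢ v → u ≢ w → v ≢ w → Shape i

  NoSingletons : Set
  NoSingletons = ∀ {i} u → colour u ≡ i → ¬ (∀ w → colour w ≡ i → w ≡ u)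

  shape : NoSingletons → ∀ i → Shape i
  shape no-singletons i with surj i
  ... | u , cu with anyVertex? (λ w → (colour w ≟ i) ×-dec ¬? (w ≟ᵥ u))
  ...   | no ∄v =
    ⊥-elim (no-singletons u cu λ w cw → decidable-stable (w ≟ᵥ u) λ w≢u → ∄v (w , cw , w≢u))
  ...   | yes (v , cv , v≢u)
    with anyVertex? (λ w → (colour w ≟ i) ×-dec (¬? (w ≟ᵥ u) ×-dec ¬? (w ≟ᵥ v)))
  ...     | yes (w , cw , w≢u , w≢v) = triple u v w cu cv cw (v≢u ∘ sym) (w≢u ∘ sym) (w≢v ∘ sym)
  ...     | no ∄w = exact-pair (ordered-pair (v≢u ∘ sym) cu cv exhaustive)
    where
    exhaustive : ∀ x → colour x ≡ i → x ≡ u ⊎ x ≡ v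
    exhaustive x cx with x ≟ᵥ u | x ≟ᵥ v
    ... | yes x≡u | _ = inj₁ x≡u
    ... | no _ | yes x≡v = inj₂ x≡v
    ... | no x≢u | no x≢v = ⊥-elim (∄w (x , cx , x≢u , x≢v))

  NoTwinPairs : Set
  NoTwinPairs = ∀ {i i'} → i ≢ i' → (P : ExactPair i) (P' : Pair i') →
                row (Pair.lower P') ≡ row (ExactPair.lower P) →
                row (Pair.upper P') ≡ row (ExactPair.upper P) → ⊥

  module _ {r : ℕ} (code : Fin (2 + n) → Fin (2 + n) → Fin r)
           (code-injective : ∀ {a a' b b'} → a Fin.< a' → b Fin.< b' →
                             code a a' ≡ code b b' → a ≡ b × a' ≡ b')
           where

    Token : Set
    Token = Vertex ⊎ Fin r

    rows-code : ∀ {i} → ExactPair i → Fin r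
    rows-code P = code (row (ExactPair.lower P)) (row (ExactPair.upper P))

    TokenOf : Fin k → Token → Set
    TokenOf i (inj₁ w) = colour w ≡ i
    TokenOf i (inj₂ c) = Σ[ P ∈ ExactPair i ] rows-code P ≡ c

    tokens : ∀ {i} → Shape i → Fin 3 → Token
    tokens (exact-pair P) =
      three (inj₁ (ExactPair.lower P)) (inj₁ (ExactPair.upper P)) (inj₂ (rows-code P))
    tokens (triple u v w _ _ _ _ _ _) = three (inj₁ u) (inj₁ v) (inj₁ w)

    tokens-injective : ∀ {i} (S : Shape i) → Injective _≡_ _≡_ (tokens S)
    tokens-injective (exact-pair P) =
      three-injective (ExactPair.lower≢upper P ∘ inj₁-injective) (λ ()) (λ ())
    tokens-injective (triple _ _ _ _ _ _ u≢v u≢w v≢w) =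
      three-injective (u≢v ∘ inj₁-injective) (u≢w ∘ inj₁-injective) (v≢w ∘ inj₁-injective)

    tokens-of : ∀ {i} (S : Shape i) s → TokenOf i (tokens S s)
    tokens-of {i} (exact-pair P) =
      three-all {P = TokenOf i} (ExactPair.lower-colour P) (ExactPair.upper-colour P) (P , refl)
    tokens-of {i} (triple _ _ _ cu cv cw _ _ _) = three-all {P = TokenOf i} cu cv cw

    token-owner-unique : NoTwinPairs → ∀ {i i' t} → i ≢ i' → TokenOf i t → TokenOf i' t → ⊥
    token-owner-unique _ {t = inj₁ w} i≢i' cw cw' = i≢i' (trans (sym cw) cw')
    token-owner-unique no-twins {t = inj₂ c} i≢i' (P , cP) (P' , cP')
      with code-injective (ExactPair.rows-ordered P') (ExactPair.rows-ordered P) (trans cP' (sym cP))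
    ... | same-lower , same-upper = no-twins i≢i' P (ExactPair.pair P') same-lower same-upper

    token-bound : NoSingletons → NoTwinPairs → k * 3 ≤ (2 + n) * q + r
    token-bound no-singletons no-twins =
      injection⇒≤ *↔× ((*↔× ⊎-↔ ↔-refl) ↔-∘ +↔⊎) (mk↣ F-injective)
      where
      F : Fin k × Fin 3 → Token
      F (i , s) = tokens (shape no-singletons i) s

      F-injective : Injective _≡_ _≡_ F
      F-injective {i , s} {i' , s'} e with i ≟ i'
      ... | yes refl = cong (i ,_) (tokens-injective (shape no-singletons i) e)
      ... | no i≢i' = ⊥-elim (token-owner-unique no-twins i≢i' (tokens-of (shape no-singletons i) s)
                                 (subst (TokenOf i') (sym e) (tokens-of (shape no-singletons i') s')))

-- Only the entries above the diagonal are ever used.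
rowPairCodes : Vec (Vec (Fin 15) 6) 6
rowPairCodes =
  (# 0 ∷ # 0 ∷ # 1 ∷ # 2 ∷ # 3  ∷ # 4  ∷ []) ∷
  (# 0 ∷ # 0 ∷ # 5 ∷ # 6 ∷ # 7  ∷ # 8  ∷ []) ∷
  (# 0 ∷ # 0 ∷ # 0 ∷ # 9 ∷ # 10 ∷ # 11 ∷ []) ∷
  (# 0 ∷ # 0 ∷ # 0 ∷ # 0 ∷ # 12 ∷ # 13 ∷ []) ∷
  (# 0 ∷ # 0 ∷ # 0 ∷ # 0 ∷ # 0  ∷ # 14 ∷ []) ∷
  (# 0 ∷ # 0 ∷ # 0 ∷ # 0 ∷ # 0  ∷ # 0  ∷ []) ∷ []

rowPairCode : Fin 6 → Fin 6 → Fin 15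
rowPairCode a a' = lookup (lookup rowPairCodes a) a'

rowPairCode-injective : ∀ {a a' b b'} → a Fin.< a' → b Fin.< b' →
                        rowPairCode a a' ≡ rowPairCode b b' → a ≡ b × a' ≡ b'
rowPairCode-injective {a} {a'} {b} {b'} = toWitness {a? = check} tt a a' b b'
  where
  check : Dec (∀ a a' b b' → a Fin.< a' → b Fin.< b' →
               rowPairCode a a' ≡ rowPairCode b b' → a ≡ b × a' ≡ b')
  check = all? λ a → all? λ a' → all? λ b → all? λ b' →
          (a <? a') →-dec ((b <? b') →-dec
            ((rowPairCode a a' ≟ rowPairCode b b') →-dec ((a ≟ b) ×-dec (a' ≟ b'))))

upper-bound : ∀ {q k} → CompleteColouring (KK 6 q) k → k ≤ 2 * q + 6
upper-bound {q} {k} C with k ℕ.≤? 2 * q + 6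
... | yes k≤ = k≤
... | no k≰ =
  ⊥-elim (<⇒≱ tokens-overflow (token-bound rowPairCode rowPairCode-injective no-singletons no-twins))
  where
  open UpperBound C
  2q+6<k : 2 * q + 6 < k
  2q+6<k = ≰⇒> k≰

  no-singletons : NoSingletons
  no-singletons u cu only-u = <⇒≱ (≤-<-trans (+-mono-≤ (m≤n*m q 2) (n≤1+n 5)) 2q+6<k)
                                  (singleton-class-bound u cu only-u)

  no-twins : NoTwinPairs
  no-twins i≢i' P P' same-lower same-upper =
    <⇒≱ (subst (_< k + 2) (twin-count q) (+-monoˡ-< 2 2q+6<k))
        (twin-pairs-bound i≢i' P P' same-lower same-upper)
    where
    twin-count : ∀ q → (2 * q + 6) + 2 ≡ (q + q) + (4 + 4)
    twin-count = solve-∀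

  tokens-overflow : 6 * q + 15 < k * 3
  tokens-overflow =
    ≤-trans (subst (6 * q + 15 <_) (token-count q) (m<m+n _ (s≤s z≤n))) (*-monoˡ-≤ 3 2q+6<k)
    where
    token-count : ∀ q → (6 * q + 15) + 6 ≡ ℕ.suc (2 * q + 6) * 3
    token-count = solve-∀

module _ {p : ℕ} where

  KAdj? : ∀ {q} (u v : Fin p × Fin q) → Dec (KAdj p q u v)
  KAdj? (a , b) (a' , b') = ((a ≟ a') ×-dec ¬? (b ≟ b')) ⊎-dec (¬? (a ≟ a') ×-dec (b ≟ b'))

  embed-KAdj : ∀ {q q' a a' b b'} {f : Fin q → Fin q'} → Injective _≡_ _≡_ f →
               KAdj p q (a , b) (a' , b') → KAdj p q' (a , f b) (a' , f b')
  embed-KAdj f-inj (inj₁ (a≡a' , b≢b')) = inj₁ (a≡a' , λ e → b≢b' (f-inj e))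
  embed-KAdj f-inj (inj₂ (a≢a' , b≡b')) = inj₂ (a≢a' , cong _ b≡b')

  reflect-KAdj : ∀ {q q' a a' b b'} {f : Fin q → Fin q'} → Injective _≡_ _≡_ f →
                 KAdj p q' (a , f b) (a' , f b') → KAdj p q (a , b) (a' , b')
  reflect-KAdj f-inj (inj₁ (a≡a' , fb≢fb')) = inj₁ (a≡a' , λ e → fb≢fb' (cong _ e))
  reflect-KAdj f-inj (inj₂ (a≢a' , fb≡fb')) = inj₂ (a≢a' , f-inj fb≡fb')

  module _ {q k : ℕ} (colour : Fin p × Fin q → Fin k) where

    Proper : Set
    Proper = ∀ u v → KAdj p q u v → colour u ≢ colour v

    Edge : Fin k → Fin k → Set
    Edge i j = ∃[ u ] ∃[ v ] (KAdj p q u v × colour u ≡ i × colour v ≡ j)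

    OccursInRow : Fin k → Fin p → Set
    OccursInRow i r = ∃[ b ] colour (r , b) ≡ i

    OccursInColumn : Fin k → Fin q → Set
    OccursInColumn i b = ∃[ r ] colour (r , b) ≡ i

    same-row⇒Edge : ∀ {i j r} → i ≢ j → OccursInRow i r → OccursInRow j r → Edge i j
    same-row⇒Edge i≢j (b , ci) (b' , cj) =
      _ , _ , inj₁ (refl , λ { refl → i≢j (trans (sym ci) cj) }) , ci , cj

    same-column⇒Edge : ∀ {i j b} → i ≢ j → OccursInColumn i b → OccursInColumn j b → Edge i j
    same-column⇒Edge i≢j (r , ci) (r' , cj) =
      _ , _ , inj₂ ((λ { refl → i≢j (trans (sym ci) cj) }) , refl) , ci , cj

    Meet : Fin k → Fin k → Set
    Meet i j = ∃[ a ] ∃[ b ] (colour (a , b) ≡ i × (OccursInRow j a ⊎ OccursInColumn j b))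

    Meet⇒Edge : ∀ {i j} → i ≢ j → Meet i j → Edge i j
    Meet⇒Edge i≢j (a , b , ci , inj₁ j∈a) = same-row⇒Edge i≢j (b , ci) j∈a
    Meet⇒Edge i≢j (a , b , ci , inj₂ j∈b) = same-column⇒Edge i≢j (a , ci) j∈b

    Surjective : Set
    Surjective = ∀ i → ∃[ u ] colour u ≡ i

    IsComplete : Set
    IsComplete = Proper × Surjective × (∀ i j → i ≢ j → Meet i j)

    toCompleteColouring : IsComplete → CompleteColouring (KK p q) k
    toCompleteColouring (proper , surj , meet) = record
      { colour = colour ; proper = proper ; surj = surj
      ; complete = λ i j i≢j → Meet⇒Edge i≢j (meet i j i≢j) }

    proper? : Dec Proper
    proper? = map′ (λ h (a , b) (a' , b') → h a b a' b') (λ h a b a' b' → h (a , b) (a' , b'))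
      (all? λ a → all? λ b → all? λ a' → all? λ b' →
        KAdj? (a , b) (a' , b') →-dec ¬? (colour (a , b) ≟ colour (a' , b')))

    surjective? : Dec Surjective
    surjective? = map′ (λ h i → pair (h i)) (λ h i → unpair (h i))
      (all? λ i → any? λ a → any? λ b → colour (a , b) ≟ i)
      where
      pair : ∀ {i} → ∃[ a ] ∃[ b ] colour (a , b) ≡ i → ∃[ u ] colour u ≡ i
      pair (a , b , e) = (a , b) , e
      unpair : ∀ {i} → ∃[ u ] colour u ≡ i → ∃[ a ] ∃[ b ] colour (a , b) ≡ i
      unpair ((a , b) , e) = a , b , e

    meet? : ∀ i j → Dec (Meet i j)
    meet? i j = any? λ a → any? λ b → (colour (a , b) ≟ i) ×-dec
                  ((any? λ b' → colour (a , b') ≟ j) ⊎-dec (any? λ a' → colour (a' , b) ≟ j))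

    isComplete? : Dec IsComplete
    isComplete? = proper? ×-dec surjective? ×-dec (all? λ i → all? λ j → ¬? (i ≟ j) →-dec meet? i j)

Table : ℕ → ℕ → ℕ → Set
Table p q k = Vec (Vec (Fin k) q) p

tableColour : ∀ {p q k} → Table p q k → Fin p × Fin q → Fin k
tableColour T (a , b) = lookup (lookup T a) b

module Juxtaposition {p c q m k : ℕ} (new : Fin p × Fin c → Fin m) (old : Fin p × Fin q → Fin k) where

  colour : Fin p × Fin (c + q) → Fin (m + k)
  colour (r , j) = [ (λ x → new (r , x) ↑ˡ k) , (λ y → m ↑ʳ old (r , y)) ]′ (splitAt c j)

  colour-new : ∀ r x → colour (r , x ↑ˡ q) ≡ new (r , x) ↑ˡ k
  colour-new r x rewrite splitAt-↑ˡ c x q = refl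

  colour-old : ∀ r y → colour (r , c ↑ʳ y) ≡ m ↑ʳ old (r , y)
  colour-old r y rewrite splitAt-↑ʳ c q y = refl

  proper : Proper new → Proper old → Proper colour
  proper new-proper old-proper (r , j) (r' , j') adj with split c q j | split c q j'
  ... | left x | left x' = λ e →
    new-proper _ _ (reflect-KAdj (↑ˡ-injective q _ _) adj)
      (↑ˡ-injective k _ _ (trans (sym (colour-new r x)) (trans e (colour-new r' x'))))
  ... | left x | right y' = λ e →
    ↑ˡ≢↑ʳ _ _ (trans (sym (colour-new r x)) (trans e (colour-old r' y')))
  ... | right y | left x' = λ e →
    ↑ˡ≢↑ʳ _ _ (trans (sym (colour-new r' x')) (trans (sym e) (colour-old r y)))
  ... | right y | right y' = λ e →
    old-proper _ _ (reflect-KAdj (↑ʳ-injective c _ _) adj)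
      (↑ʳ-injective m _ _ (trans (sym (colour-old r y)) (trans e (colour-old r' y'))))

  new-occurs : ∀ {n r} → OccursInRow new n r → OccursInRow colour (n ↑ˡ k) r
  new-occurs (x , e) = x ↑ˡ q , trans (colour-new _ x) (cong (_↑ˡ k) e)

  old-occurs : ∀ {i r} → OccursInRow old i r → OccursInRow colour (m ↑ʳ i) r
  old-occurs (y , e) = c ↑ʳ y , trans (colour-old _ y) (cong (m ↑ʳ_) e)

  old-Edge : ∀ {i j} → Edge old i j → Edge colour (m ↑ʳ i) (m ↑ʳ j)
  old-Edge ((r , y) , (r' , y') , adj , ci , cj) =
    (r , c ↑ʳ y) , (r' , c ↑ʳ y') , embed-KAdj (↑ʳ-injective c _ _) adj ,
    trans (colour-old r y) (cong (m ↑ʳ_) ci) , trans (colour-old r' y') (cong (m ↑ʳ_) cj)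

-- Rows 0, …, 5 are the edges 01, 02, 03, 12, 13, 23 of K₄, and star s lists the edges at vertex s.
stars : Vec (Vec (Fin 6) 3) 4
stars =
  (# 0 ∷ # 1 ∷ # 2 ∷ []) ∷
  (# 0 ∷ # 3 ∷ # 4 ∷ []) ∷
  (# 1 ∷ # 3 ∷ # 5 ∷ []) ∷
  (# 2 ∷ # 4 ∷ # 5 ∷ []) ∷
  []

star : Fin 4 → Fin 3 → Fin 6
star s t = lookup (lookup stars s) t

stars-meet : ∀ s s' → ∃[ t ] ∃[ t' ] star s t ≡ star s' t'
stars-meet = toWitness {a? = all? λ s → all? λ s' → any? λ t → any? λ t' → star s t ≟ star s' t'} tt

MeetsStars : ∀ {q k} → (Fin 6 × Fin q → Fin k) → Set
MeetsStars colour = ∀ i s → ∃[ t ] OccursInRow colour i (star s t)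

meetsStars? : ∀ {q k} (colour : Fin 6 × Fin q → Fin k) → Dec (MeetsStars colour)
meetsStars? colour = all? λ i → all? λ s → any? λ t → any? λ b → colour (star s t , b) ≟ i

Covers : ∀ {c m} → (Fin 6 × Fin c → Fin m) → (Fin m → Fin 4) → Set
Covers colour centre = ∀ n t → OccursInRow colour n (star (centre n) t)

covers? : ∀ {c m} (colour : Fin 6 × Fin c → Fin m) (centre : Fin m → Fin 4) → Dec (Covers colour centre)
covers? colour centre = all? λ n → all? λ t → any? λ b → colour (star (centre n) t , b) ≟ n

record StarColouring (q : ℕ) : Set where
  field
    k : ℕ
    enough : 2 * q + 3 ≤ k
    colouring : CompleteColouring (KK 6 q) k
  open CompleteColouring colouring public
  field
    meets-stars : MeetsStars colour

record StarBlock (c : ℕ) : Set where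
  field
    colour : Fin 6 × Fin c → Fin (2 * c)
    proper : Proper colour
    centre : Fin (2 * c) → Fin 4
    covers : Covers colour centre

extend : ∀ {c q} → StarBlock c → StarColouring q → StarColouring (c + q)
extend {c} {q} B S = record
  { k = 2 * c + S.k
  ; enough = more-enough
  ; colouring = record { colour = colour ; proper = proper B.proper S.proper ; surj = surj ; complete = complete }
  ; meets-stars = meets-stars
  }
  where
  module B = StarBlock B
  module S = StarColouring S
  open Juxtaposition B.colour S.colour

  more-enough : 2 * (c + q) + 3 ≤ 2 * c + S.k
  more-enough = subst (_≤ 2 * c + S.k) (sym (regroup c q)) (+-monoʳ-≤ (2 * c) S.enough)
    where
    regroup : ∀ c q → 2 * (c + q) + 3 ≡ 2 * c + (2 * q + 3)
    regroup = solve-∀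

  meets-stars : MeetsStars colour
  meets-stars z s with split (2 * c) S.k z
  ... | left n with stars-meet s (B.centre n)
  ...   | t , t' , same = t , subst (OccursInRow colour (n ↑ˡ S.k)) (sym same) (new-occurs (B.covers n t'))
  meets-stars z s | right i with S.meets-stars i s
  ...   | t , i∈t = t , old-occurs i∈t

  surj : ∀ z → ∃[ u ] colour u ≡ z
  surj z with split (2 * c) S.k z
  ... | left n = let x , e = new-occurs (B.covers n (# 0)) in (_ , x) , e
  ... | right i = let (r , y) , e = S.surj i in (r , c ↑ʳ y) , proj₂ (old-occurs (y , e))

  new-shares-row : ∀ n z → ∃[ r ] OccursInRow colour (n ↑ˡ S.k) r × OccursInRow colour z r
  new-shares-row n z with meets-stars z (B.centre n)
  ... | t , z∈t = star (B.centre n) t , new-occurs (B.covers n t) , z∈t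

  complete : ∀ z z' → z ≢ z' → Edge colour z z'
  complete z z' z≢z' with split (2 * c) S.k z | split (2 * c) S.k z'
  ... | left n | _ = let _ , n∈r , z'∈r = new-shares-row n z' in same-row⇒Edge colour z≢z' n∈r z'∈r
  ... | right i | left n = let _ , n∈r , z∈r = new-shares-row n z in same-row⇒Edge colour z≢z' z∈r n∈r
  ... | right i | right i' = old-Edge (S.complete i i' λ e → z≢z' (cong (2 * c ↑ʳ_) e))

decidedColouring : ∀ {p q k} (colour : Fin p × Fin q → Fin k) →
                   True (isComplete? colour) → CompleteColouring (KK p q) k
decidedColouring colour ok = toCompleteColouring colour (toWitness ok)

tableStarColouring : ∀ {q k} (T : Table 6 q k) → 2 * q + 3 ≤ k → True (isComplete? (tableColour T)) →
                     True (meetsStars? (tableColour T)) → StarColouring q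
tableStarColouring T enough complete meets = record
  { enough = enough
  ; colouring = decidedColouring (tableColour T) complete
  ; meets-stars = toWitness meets
  }

tableStarBlock : ∀ {c} (T : Table 6 c (2 * c)) (centres : Vec (Fin 4) (2 * c)) →
                 True (proper? (tableColour T)) → True (covers? (tableColour T) (lookup centres)) → StarBlock c
tableStarBlock T centres proper covers = record
  { colour = tableColour T
  ; proper = toWitness proper
  ; centre = lookup centres
  ; covers = toWitness covers
  }

table₂ : Table 6 2 7
table₂ =
  (# 6 ∷ # 4 ∷ []) ∷
  (# 4 ∷ # 2 ∷ []) ∷
  (# 3 ∷ # 6 ∷ []) ∷
  (# 2 ∷ # 5 ∷ []) ∷
  (# 5 ∷ # 3 ∷ []) ∷
  (# 0 ∷ # 1 ∷ []) ∷
  []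

table₃ : Table 6 3 9
table₃ =
  (# 0 ∷ # 4 ∷ # 2 ∷ []) ∷
  (# 5 ∷ # 7 ∷ # 6 ∷ []) ∷
  (# 1 ∷ # 3 ∷ # 8 ∷ []) ∷
  (# 3 ∷ # 8 ∷ # 1 ∷ []) ∷
  (# 6 ∷ # 5 ∷ # 7 ∷ []) ∷
  (# 2 ∷ # 0 ∷ # 4 ∷ []) ∷
  []

table₄ : Table 6 4 11
table₄ =
  (# 3  ∷ # 2  ∷ # 8  ∷ # 7  ∷ []) ∷
  (# 4  ∷ # 0  ∷ # 1  ∷ # 10 ∷ []) ∷
  (# 10 ∷ # 6  ∷ # 9  ∷ # 5  ∷ []) ∷
  (# 6  ∷ # 10 ∷ # 5  ∷ # 9  ∷ []) ∷
  (# 9  ∷ # 1  ∷ # 0  ∷ # 4  ∷ []) ∷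
  (# 8  ∷ # 7  ∷ # 3  ∷ # 2  ∷ []) ∷
  []

table₅ : Table 6 5 13
table₅ =
  (# 2  ∷ # 6  ∷ # 7  ∷ # 11 ∷ # 0  ∷ []) ∷
  (# 6  ∷ # 0  ∷ # 8  ∷ # 12 ∷ # 7  ∷ []) ∷
  (# 12 ∷ # 5  ∷ # 2  ∷ # 3  ∷ # 4  ∷ []) ∷
  (# 9  ∷ # 10 ∷ # 11 ∷ # 4  ∷ # 1  ∷ []) ∷
  (# 10 ∷ # 9  ∷ # 0  ∷ # 8  ∷ # 3  ∷ []) ∷
  (# 1  ∷ # 7  ∷ # 5  ∷ # 6  ∷ # 8  ∷ []) ∷
  []

table₆ : Table 6 6 15
table₆ =
  (# 4  ∷ # 9  ∷ # 5  ∷ # 6  ∷ # 3  ∷ # 14 ∷ []) ∷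
  (# 0  ∷ # 11 ∷ # 6  ∷ # 2  ∷ # 5  ∷ # 12 ∷ []) ∷
  (# 14 ∷ # 13 ∷ # 1  ∷ # 7  ∷ # 10 ∷ # 2  ∷ []) ∷
  (# 7  ∷ # 4  ∷ # 8  ∷ # 10 ∷ # 13 ∷ # 3  ∷ []) ∷
  (# 8  ∷ # 12 ∷ # 13 ∷ # 4  ∷ # 1  ∷ # 11 ∷ []) ∷
  (# 2  ∷ # 7  ∷ # 9  ∷ # 5  ∷ # 0  ∷ # 10 ∷ []) ∷
  []

block₄-table : Table 6 4 (2 * 4)
block₄-table =
  (# 0 ∷ # 1 ∷ # 2 ∷ # 3 ∷ []) ∷
  (# 1 ∷ # 0 ∷ # 4 ∷ # 5 ∷ []) ∷
  (# 6 ∷ # 7 ∷ # 0 ∷ # 1 ∷ []) ∷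
  (# 2 ∷ # 3 ∷ # 5 ∷ # 4 ∷ []) ∷
  (# 3 ∷ # 2 ∷ # 6 ∷ # 7 ∷ []) ∷
  (# 4 ∷ # 5 ∷ # 7 ∷ # 6 ∷ []) ∷
  []

block₄-centres : Vec (Fin 4) (2 * 4)
block₄-centres = # 0 ∷ # 0 ∷ # 1 ∷ # 1 ∷ # 2 ∷ # 2 ∷ # 3 ∷ # 3 ∷ []

block₆-table : Table 6 6 (2 * 6)
block₆-table =
  (# 0  ∷ # 1  ∷ # 2  ∷ # 3  ∷ # 4  ∷ # 5  ∷ []) ∷
  (# 1  ∷ # 0  ∷ # 6  ∷ # 2  ∷ # 7  ∷ # 8  ∷ []) ∷
  (# 2  ∷ # 9  ∷ # 0  ∷ # 1  ∷ # 10 ∷ # 11 ∷ []) ∷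
  (# 3  ∷ # 4  ∷ # 5  ∷ # 6  ∷ # 8  ∷ # 7  ∷ []) ∷
  (# 4  ∷ # 3  ∷ # 9  ∷ # 5  ∷ # 11 ∷ # 10 ∷ []) ∷
  (# 7  ∷ # 8  ∷ # 10 ∷ # 11 ∷ # 6  ∷ # 9  ∷ []) ∷
  []

block₆-centres : Vec (Fin 4) (2 * 6)
block₆-centres = # 0 ∷ # 0 ∷ # 0 ∷ # 1 ∷ # 1 ∷ # 1 ∷ # 2 ∷ # 2 ∷ # 2 ∷ # 3 ∷ # 3 ∷ # 3 ∷ []

block₄ : StarBlock 4
block₄ = tableStarBlock block₄-table block₄-centres tt tt

block₆ : StarBlock 6
block₆ = tableStarBlock block₆-table block₆-centres tt tt

starColouring₃ : StarColouring 3
starColouring₃ = tableStarColouring table₃ ≤-refl tt tt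

starColouring₄ : StarColouring 4
starColouring₄ = tableStarColouring table₄ ≤-refl tt tt

starColouring : ∀ r → StarColouring (7 + r)
starColouring 0 = extend block₄ starColouring₃
starColouring 1 = extend block₄ starColouring₄
starColouring 2 = extend block₆ starColouring₃
starColouring 3 = extend block₆ starColouring₄
starColouring (ℕ.suc (ℕ.suc (ℕ.suc (ℕ.suc r)))) = extend block₄ (starColouring r)

achrGE-star : ∀ {q} → StarColouring q → AchrGE (KK 6 q) (2 * q + 3)
achrGE-star S = k , enough , colouring
  where open StarColouring S

lower-bound : ∀ q → 1 ≤ q → AchrGE (KK 6 q) (2 * q + 3)
lower-bound 0 ()
lower-bound 1 _ = 6 , n≤1+n 5 , decidedColouring proj₁ tt
lower-bound 2 _ = 7 , ≤-refl , decidedColouring (tableColour table₂) tt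
lower-bound 3 _ = achrGE-star starColouring₃
lower-bound 4 _ = achrGE-star starColouring₄
lower-bound 5 _ = 13 , ≤-refl , decidedColouring (tableColour table₅) tt
lower-bound 6 _ = 15 , ≤-refl , decidedColouring (tableColour table₆) tt
lower-bound (ℕ.suc (ℕ.suc (ℕ.suc (ℕ.suc (ℕ.suc (ℕ.suc (ℕ.suc r))))))) _ = achrGE-star (starColouring r)

corollary17 : (q : ℕ) → 1 ≤ q →
    AchrGE (KK 6 q) (2 * q + 3) × AchrLE (KK 6 q) (2 * q + 6)
corollary17 q 1≤q = lower-bound q 1≤q , λ _ → upper-bound
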